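{- The set of primitive ray generators of any chamber of the bipermutohedral fan $\Sigma_{E,E}$ is a basis of the free abelian group $\mathbb Z^E/\mathbb Z\mathbf e_E\oplus\mathbb Z^E/\mathbb Z\mathbf f_E$. In particular, $\Sigma_{E,E}$ is simplicial.
   Context: $E=\{0,\ldots,n\}$, $n\ge1$; $\N_{E,E}=\mathbb R^E/\mathbb R\mathbf e_E\oplus\mathbb R^E/\mathbb R\mathbf f_E$, where $\mathbf e_i$ (resp. $\mathbf f_i$) are the standard basis vectors of the first (resp. second) copy of $\mathbb R^E$, $\mathbf e_E=\sum_i\mathbf e_i$, $\mathbf f_E=\sum_i\mathbf f_i$; points are written $(z,w)$. For $k\in E$ let $\mathscr C_k=\{(z,w):\min_{i}(z_i+w_i)=z_k+w_k\}$ with coordinates $Z_i=z_i-z_k$, $W_i=-w_i+w_k$; subdivide $\mathscr C_k$ by all hyperplanes $Z_a=Z_b$, $W_a=W_b$, $Z_a=W_b$ ($a,b\in E$). The bipermutohedral fan $\Sigma_{E,E}$ is the union of these subdivisions over $k\in E$.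
   Formalization: The space $\N_{E,E}$ is taken over ℚ instead of ℝ, so the chambers of $\Sigma_{E,E}$ and the points tested for extreme rays consist of rational points. -}

module Defs where

open import Data.Nat using (ℕ; zero; suc)
open import Data.Fin using (Fin; zero; suc)
open import Data.Integer as ℤ using (ℤ; +_)
open import Data.Rational as ℚ using (ℚ; 0ℚ; _/_)
open import Data.Product using (Σ; ∃; ∃-syntax; _×_; _,_)
open import Relation.Binary.PropositionalEquality using (_≡_; _≢_)
open import Relation.Nullary using (¬_)

E : ℕ → Set
E n = Fin (suc n)

-- N_{E,E} ⊗ ℚ : pairs (z , w) of ℚ-vectors on E, modulo adding
-- constant vectors to z and (independently) to w.

QPt : ℕ → Set
QPt n = (E n → ℚ) × (E n → ℚ)

_≈Q_ : ∀ {n} → QPt n → QPt n → Set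
_≈Q_ {n} (z , w) (z' , w') =
  (∀ i j → z i ℚ.- z' i ≡ z j ℚ.- z' j) × (∀ i j → w i ℚ.- w' i ≡ w j ℚ.- w' j)

0Q : ∀ {n} → QPt n
0Q = (λ _ → 0ℚ) , (λ _ → 0ℚ)

_+Q_ : ∀ {n} → QPt n → QPt n → QPt n
(z , w) +Q (z' , w') = (λ i → z i ℚ.+ z' i) , (λ i → w i ℚ.+ w' i)

_•Q_ : ∀ {n} → ℚ → QPt n → QPt n
t •Q (z , w) = (λ i → t ℚ.* z i) , (λ i → t ℚ.* w i)

sumQ : ∀ {n m} → (Fin m → QPt n) → QPt n
sumQ {m = zero}  f = 0Q
sumQ {m = suc m} f = f zero +Q sumQ (λ i → f (suc i))

ZPt : ℕ → Set
ZPt n = (E n → ℤ) × (E n → ℤ)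

_≈Z_ : ∀ {n} → ZPt n → ZPt n → Set
_≈Z_ {n} (z , w) (z' , w') =
  (∀ i j → z i ℤ.- z' i ≡ z j ℤ.- z' j) × (∀ i j → w i ℤ.- w' i ≡ w j ℤ.- w' j)

0Z : ∀ {n} → ZPt n
0Z = (λ _ → + 0) , (λ _ → + 0)

_+Z_ : ∀ {n} → ZPt n → ZPt n → ZPt n
(z , w) +Z (z' , w') = (λ i → z i ℤ.+ z' i) , (λ i → w i ℤ.+ w' i)

_•Z_ : ∀ {n} → ℤ → ZPt n → ZPt n
t •Z (z , w) = (λ i → t ℤ.* z i) , (λ i → t ℤ.* w i)

sumZ : ∀ {n m} → (Fin m → ZPt n) → ZPt n
sumZ {m = zero}  f = 0Z
sumZ {m = suc m} f = f zero +Z sumZ (λ i → f (suc i))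

ι : ∀ {n} → ZPt n → QPt n
ι (z , w) = (λ i → z i / 1) , (λ i → w i / 1)

Zc : ∀ {n} → E n → QPt n → E n → ℚ
Zc k (z , w) i = z i ℚ.- z k

Wc : ∀ {n} → E n → QPt n → E n → ℚ
Wc k (z , w) i = w k ℚ.- w i

-- C_k = { min_i (z_i + w_i) = z_k + w_k }  =  { ∀ i, W_i ≤ Z_i }
InC : ∀ {n} → E n → QPt n → Set
InC k x = ∀ i → Wc k x i ℚ.≤ Zc k x i

-- The linear forms whose zero sets are the subdividing hyperplanes
-- Z_a = Z_b, W_a = W_b, Z_a = W_b.
data Form (n : ℕ) : Set where
  zz ww zw : E n → E n → Form n

evalF : ∀ {n} → E n → Form n → QPt n → ℚ
evalF k (zz a b) x = Zc k x a ℚ.- Zc k x b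
evalF k (ww a b) x = Wc k x a ℚ.- Wc k x b
evalF k (zw a b) x = Zc k x a ℚ.- Wc k x b

-- the forms that are not identically zero on N (i.e. that define
-- genuine hyperplanes)
Nontrivial : ∀ {n} → E n → Form n → Set
Nontrivial k (zz a b) = a ≢ b
Nontrivial k (ww a b) = a ≢ b
Nontrivial k (zw a b) = ¬ (a ≡ k × b ≡ k)

Generic : ∀ {n} → E n → QPt n → Set
Generic k x₀ = InC k x₀ × (∀ L → Nontrivial k L → evalF k L x₀ ≢ 0ℚ)

-- The (closed) chamber of the subdivision of C_k containing the generic
-- point x₀: the closure of the connected component of
-- C_k ∖ (hyperplanes) containing x₀.  Every chamber of Σ_{E,E} is of
-- this form for some k and some generic rational x₀.
Chamber : ∀ {n} → E n → QPt n → QPt n → Set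
Chamber k x₀ x =
  InC k x ×
  (∀ L → (0ℚ ℚ.< evalF k L x₀ → 0ℚ ℚ.≤ evalF k L x) ×
         (evalF k L x₀ ℚ.< 0ℚ → evalF k L x ℚ.≤ 0ℚ))

OnRay : ∀ {n} → QPt n → QPt n → Set
OnRay u x = ∃[ t ] (0ℚ ℚ.≤ t × x ≈Q (t •Q u))

ExtremeRay : ∀ {n} → (QPt n → Set) → QPt n → Set
ExtremeRay C u =
  C u × ¬ (u ≈Q 0Q) ×
  (∀ x y → C x → C y → OnRay u (x +Q y) → OnRay u x × OnRay u y)

PrimitiveRayGen : ∀ {n} → (QPt n → Set) → ZPt n → Set
PrimitiveRayGen C u =
  ExtremeRay C (ι u) × (∀ (m : ℕ) u′ → u ≈Z ((+ m) •Z u′) → m ≡ 1)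

IsZBasis : ∀ {n m} → (Fin m → ZPt n) → Set
IsZBasis {n} {m} v =
  (∀ (x : ZPt n) → Σ (Fin m → ℤ) λ c → x ≈Z sumZ (λ i → c i •Z v i)) ×
  (∀ (c : Fin m → ℤ) → sumZ (λ i → c i •Z v i) ≈Z 0Z → ∀ i → c i ≡ + 0)

PosHull : ∀ {n m} → (Fin m → ZPt n) → QPt n → Set
PosHull {n} {m} v x =
  Σ (Fin m → ℚ) λ c → ((∀ i → 0ℚ ℚ.≤ c i) × x ≈Q sumQ (λ i → c i •Q ι (v i)))

{-# OPTIONS --safe #-}
module Submission where

-- In the coordinates Z_i = z_i − z_k and W_i = w_k − w_i (i ≠ k) of the cone C_k, the lattice
-- ℤ^E/ℤe_E ⊕ ℤ^E/ℤf_E is ℤ^{2n}.  For a generic x₀ these 2n coordinates take pairwise distinct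
-- nonzero values, and the chamber of x₀ is the cone of points whose coordinates are weakly ordered
-- like those of x₀, with 0 kept in its place.  Listing the coordinates of each sign by distance from
-- 0, a point is determined by the jumps ±(x_s − x_{pred s}) between consecutive coordinates, which
-- are nonnegative exactly on the chamber.  Dually, the point that is ±1 on the coordinates at least
-- as far out as s on the side of s, and 0 elsewhere, has jump 1 at s and 0 at every other
-- coordinate.  Jumps and these points are dual bases over any commutative ring: the points form a
-- ℤ-basis, the chamber is the cone over them, and they are its primitive ray generators.

open import Defs
open import Data.Nat using (ℕ; _≤_)
open import Data.Fin using (Fin)
open import Data.Product using (Σ; ∃; ∃-syntax; _×_; _,_)

open import Level using (_⊔_)
open import Algebra.Bundles using (CommutativeMonoid; CommutativeRing)
import Algebra.Properties.Monoid.Sum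
open import Data.Bool.Base using (Bool; true; false; if_then_else_)
open import Data.Bool.Properties using (if-float)
open import Data.Fin.Base using (zero; suc; splitAt; join; punchIn; punchOut; _↑ˡ_; _↑ʳ_)
import Data.Fin.Properties as Finₚ
import Data.Integer as ℤ
import Data.Integer.Properties as ℤₚ
open import Data.List.Base using (List; []; _∷_; map; _++_; filter; length; allFin)
open import Data.List.Membership.Propositional using (_∈_)
open import Data.List.Membership.Propositional.Properties
  using (∈-++⁺ˡ; ∈-++⁺ʳ; ∈-map⁺; ∈-allFin; ∈-filter⁺)
import Data.List.Relation.Unary.All as All
open import Data.List.Relation.Unary.All.Properties using (all-filter)
open import Data.List.Relation.Unary.Any using (here; there)
import Data.Nat.Base as ℕ
import Data.Nat.Coprimality as Coprimality
import Data.Nat.Induction as ℕᵢ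
import Data.Nat.Properties as ℕₚ
open import Data.Product using (proj₁; proj₂)
open import Data.Rational using (ℚ; 0ℚ; 1ℚ; _/_)
import Data.Rational as ℚ
import Data.Rational.Properties as ℚₚ
open import Data.Sum.Base using (_⊎_; inj₁; inj₂; [_,_]′)
open import Data.Vec.Functional using (updateAt)
open import Data.Vec.Functional.Properties using (updateAt-updates; updateAt-minimal)
open import Function.Base using (_∘_)
open import Function.Bundles using (mk⇔)
open import Induction.WellFounded using (Acc; acc)
open import Relation.Binary.Bundles using (DecTotalOrder)
open import Relation.Binary.Definitions using (tri<; tri≈; tri>)
open import Relation.Binary.PropositionalEquality
  using (_≡_; _≢_; refl; sym; trans; cong; cong₂; subst; subst₂; module ≡-Reasoning)
open import Relation.Nullary using (¬_; Dec; yes; no; does; contradiction)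
open import Relation.Nullary.Decidable using (dec-true; dec-false; does-⇔)
open import Relation.Unary using (Pred; Decidable)

module ℚΣ = Algebra.Properties.Monoid.Sum ℚₚ.+-0-monoid

private
  variable
    p q : ℚ

p<q⇒0<q-p : p ℚ.< q → 0ℚ ℚ.< q ℚ.- p
p<q⇒0<q-p {p} {q} p<q = subst (ℚ._< q ℚ.- p) (ℚₚ.+-inverseʳ p) (ℚₚ.+-monoˡ-< (ℚ.- p) p<q)

p≤q⇒0≤q-p : p ℚ.≤ q → 0ℚ ℚ.≤ q ℚ.- p
p≤q⇒0≤q-p {p} {q} p≤q = subst (ℚ._≤ q ℚ.- p) (ℚₚ.+-inverseʳ p) (ℚₚ.+-monoˡ-≤ (ℚ.- p) p≤q)

p<q⇒p-q<0 : p ℚ.< q → p ℚ.- q ℚ.< 0ℚ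
p<q⇒p-q<0 {p} {q} p<q = subst (p ℚ.- q ℚ.<_) (ℚₚ.+-inverseʳ q) (ℚₚ.+-monoˡ-< (ℚ.- q) p<q)

p≤q⇒p-q≤0 : p ℚ.≤ q → p ℚ.- q ℚ.≤ 0ℚ
p≤q⇒p-q≤0 {p} {q} p≤q = subst (p ℚ.- q ℚ.≤_) (ℚₚ.+-inverseʳ q) (ℚₚ.+-monoˡ-≤ (ℚ.- q) p≤q)

p-q+q≡p : ∀ p q → p ℚ.- q ℚ.+ q ≡ p
p-q+q≡p p q = trans (ℚₚ.+-assoc p (ℚ.- q) q)
                    (trans (cong (p ℚ.+_) (ℚₚ.+-inverseˡ q)) (ℚₚ.+-identityʳ p))

0<q-p⇒p<q : 0ℚ ℚ.< q ℚ.- p → p ℚ.< q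
0<q-p⇒p<q {q} {p} 0<q-p =
  subst₂ ℚ._<_ (ℚₚ.+-identityˡ p) (p-q+q≡p q p) (ℚₚ.+-monoˡ-< p 0<q-p)

0≤q-p⇒p≤q : 0ℚ ℚ.≤ q ℚ.- p → p ℚ.≤ q
0≤q-p⇒p≤q {q} {p} 0≤q-p =
  subst₂ ℚ._≤_ (ℚₚ.+-identityˡ p) (p-q+q≡p q p) (ℚₚ.+-monoˡ-≤ p 0≤q-p)

p-q<0⇒p<q : p ℚ.- q ℚ.< 0ℚ → p ℚ.< q
p-q<0⇒p<q {p} {q} p-q<0 =
  subst₂ ℚ._<_ (p-q+q≡p p q) (ℚₚ.+-identityˡ q) (ℚₚ.+-monoˡ-< q p-q<0)

p-q≤0⇒p≤q : p ℚ.- q ℚ.≤ 0ℚ → p ℚ.≤ q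
p-q≤0⇒p≤q {p} {q} p-q≤0 =
  subst₂ ℚ._≤_ (p-q+q≡p p q) (ℚₚ.+-identityˡ q) (ℚₚ.+-monoˡ-≤ q p-q≤0)

p≡q⇒p-q≡0 : p ≡ q → p ℚ.- q ≡ 0ℚ
p≡q⇒p-q≡0 {p} refl = ℚₚ.+-inverseʳ p

<⇒≱ : p ℚ.< q → ¬ q ℚ.≤ p
<⇒≱ p<q q≤p = ℚₚ.<-irrefl refl (ℚₚ.<-≤-trans p<q q≤p)

≤∧≢⇒< : p ℚ.≤ q → p ≢ q → p ℚ.< q
≤∧≢⇒< {p} {q} p≤q p≢q with ℚₚ.<-cmp p q
... | tri< p<q _ _ = p<q
... | tri≈ _ p≡q _ = contradiction p≡q p≢q
... | tri> _ _ q<p = contradiction p≤q (<⇒≱ q<p)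

neg-involutive : ∀ p → ℚ.- (ℚ.- p) ≡ p
neg-involutive = -‿involutive
  where open import Algebra.Properties.Ring ℚₚ.+-*-ring using (-‿involutive)

neg-cancel-< : ℚ.- p ℚ.< ℚ.- q → q ℚ.< p
neg-cancel-< {p} {q} -p<-q =
  subst₂ ℚ._<_ (neg-involutive q) (neg-involutive p) (ℚₚ.neg-antimono-< -p<-q)

0≤p∧0≤q∧p+q≡0⇒p≡0 : 0ℚ ℚ.≤ p → 0ℚ ℚ.≤ q → p ℚ.+ q ≡ 0ℚ → p ≡ 0ℚ
0≤p∧0≤q∧p+q≡0⇒p≡0 {p} 0≤p 0≤q p+q≡0 =
  ℚₚ.≤-antisym (subst₂ ℚ._≤_ (ℚₚ.+-identityʳ p) p+q≡0 (ℚₚ.+-monoʳ-≤ p 0≤q)) 0≤p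

p*q≡0∧q≢0⇒p≡0 : p ℚ.* q ≡ 0ℚ → q ≢ 0ℚ → p ≡ 0ℚ
p*q≡0∧q≢0⇒p≡0 {p} {q} pq≡0 q≢0 = begin
  p                     ≡⟨ ℚₚ.*-identityʳ p ⟨
  p ℚ.* 1ℚ              ≡⟨ cong (p ℚ.*_) (ℚₚ.*-inverseʳ q) ⟨
  p ℚ.* (q ℚ.* ℚ.1/ q)  ≡⟨ ℚₚ.*-assoc p q (ℚ.1/ q) ⟨
  p ℚ.* q ℚ.* ℚ.1/ q    ≡⟨ cong (ℚ._* ℚ.1/ q) pq≡0 ⟩
  0ℚ ℚ.* ℚ.1/ q         ≡⟨ ℚₚ.*-zeroˡ (ℚ.1/ q) ⟩
  0ℚ                    ∎
  where
  open ≡-Reasoning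
  instance
    q-nonZero : ℚ.NonZero q
    q-nonZero = ℚ.≢-nonZero q≢0

/1≡mkℚ : ∀ i → i / 1 ≡ ℚ.mkℚ i 0 (Coprimality.sym (Coprimality.1-coprimeTo ℤ.∣ i ∣))
/1≡mkℚ (ℤ.+ m)    = ℚₚ.normalize-coprime {m} {0} _
/1≡mkℚ ℤ.-[1+ m ] = cong ℚ.-_ (ℚₚ.normalize-coprime {ℕ.suc m} {0} _)

/1-injective : ∀ {i j} → i / 1 ≡ j / 1 → i ≡ j
/1-injective {i} {j} eq = cong ℚ.↥_ (trans (sym (/1≡mkℚ i)) (trans eq (/1≡mkℚ j)))

/1-homo-+ : ∀ i j → (i ℤ.+ j) / 1 ≡ i / 1 ℚ.+ j / 1
/1-homo-+ i j rewrite /1≡mkℚ i | /1≡mkℚ j =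
  cong (_/ 1) (sym (cong₂ ℤ._+_ (ℤₚ.*-identityʳ i) (ℤₚ.*-identityʳ j)))

/1-homo-* : ∀ i j → (i ℤ.* j) / 1 ≡ (i / 1) ℚ.* (j / 1)
/1-homo-* i j rewrite /1≡mkℚ i | /1≡mkℚ j = refl

/1-homo-neg : ∀ i → (ℤ.- i) / 1 ≡ ℚ.- (i / 1)
/1-homo-neg (ℤ.+ ℕ.zero) = refl
/1-homo-neg ℤ.+[1+ m ]   = refl
/1-homo-neg ℤ.-[1+ m ]   = sym (neg-involutive _)

/1-homo-− : ∀ i j → (i ℤ.- j) / 1 ≡ i / 1 ℚ.- j / 1
/1-homo-− i j = trans (/1-homo-+ i (ℤ.- j)) (cong (i / 1 ℚ.+_) (/1-homo-neg j))

/1-nonneg : ∀ {i} → 0ℚ ℚ.≤ i / 1 → ℤ.+ ℤ.∣ i ∣ ≡ i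
/1-nonneg {i} 0≤i rewrite /1≡mkℚ i =
  ℤₚ.0≤i⇒+∣i∣≡i (subst (ℤ.0ℤ ℤ.≤_) (ℤₚ.*-identityʳ i) (ℚₚ.drop-*≤* 0≤i))

does-true⇒ : ∀ {a} {A : Set a} (a? : Dec A) → does a? ≡ true → A
does-true⇒ (yes a) _ = a

module _ {a r} {A : Set a} {P Q : Pred A r} (P? : Decidable P) (Q? : Decidable Q)
         (P⇒Q : ∀ {x} → P x → Q x) where

  length-filter-mono : ∀ xs → length (filter P? xs) ℕ.≤ length (filter Q? xs)
  length-filter-mono [] = ℕ.z≤n
  length-filter-mono (x ∷ xs) with P? x | Q? x
  ... | yes _  | yes _  = ℕ.s≤s (length-filter-mono xs)
  ... | yes Px | no ¬Qx = contradiction (P⇒Q Px) ¬Qx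
  ... | no _   | yes _  = ℕₚ.m≤n⇒m≤1+n (length-filter-mono xs)
  ... | no _   | no _   = length-filter-mono xs

  length-filter-< : ∀ {x xs} → x ∈ xs → ¬ P x → Q x →
                    length (filter P? xs) ℕ.< length (filter Q? xs)
  length-filter-< {x} {.x ∷ xs} (here refl) ¬Px Qx with P? x | Q? x
  ... | yes Px | _      = contradiction Px ¬Px
  ... | no _   | yes _  = ℕ.s≤s (length-filter-mono xs)
  ... | no _   | no ¬Qx = contradiction Qx ¬Qx
  length-filter-< {x} {y ∷ xs} (there x∈xs) ¬Px Qx with P? y | Q? y
  ... | yes _  | yes _  = ℕ.s≤s (length-filter-< x∈xs ¬Px Qx)
  ... | yes Py | no ¬Qy = contradiction (P⇒Q Py) ¬Qy
  ... | no _   | yes _  = ℕₚ.m<n⇒m<1+n (length-filter-< x∈xs ¬Px Qx)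
  ... | no _   | no _   = length-filter-< x∈xs ¬Px Qx

module _ {c ℓ} (M : CommutativeMonoid c ℓ) where

  open CommutativeMonoid M renaming (_∙_ to _+_; ε to 0#)
  open import Algebra.Properties.CommutativeMonoid.Sum M
    using (sum; sum-remove; sum-cong-≋; sum-replicate-zero)
  open import Relation.Binary.Reasoning.Setoid setoid

  sum-single : ∀ {m} (f : Fin m → Carrier) i → (∀ j → j ≢ i → f j ≈ 0#) → sum f ≈ f i
  sum-single {ℕ.suc m} f i vanish = begin
    sum f                      ≈⟨ sum-remove {i = i} f ⟩
    f i + sum (f ∘ punchIn i)  ≈⟨ ∙-congˡ (sum-cong-≋ {m} λ j → vanish _ (Finₚ.punchInᵢ≢i i j)) ⟩
    f i + sum {m} (λ _ → 0#)   ≈⟨ ∙-congˡ (sum-replicate-zero m) ⟩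
    f i + 0#                   ≈⟨ identityʳ (f i) ⟩
    f i                        ∎

sum-mono-≤ : ∀ {m} {f g : Fin m → ℚ} → (∀ j → f j ℚ.≤ g j) → ℚΣ.sum f ℚ.≤ ℚΣ.sum g
sum-mono-≤ {ℕ.zero}  f≤g = ℚₚ.≤-refl
sum-mono-≤ {ℕ.suc m} f≤g = ℚₚ.+-mono-≤ (f≤g zero) (sum-mono-≤ (f≤g ∘ suc))

-- Z i and W i stand for the coordinates Z_i and W_i of the cone C_k; Z k and W k vanish identically.
data Coord (n : ℕ) : Set where
  Z W : E n → Coord n

index : ∀ {n} → Coord n → E n
index (Z i) = i
index (W i) = i

Z-injective : ∀ {n} {i j : E n} → Z i ≡ Z j → i ≡ j
Z-injective refl = refl

W-injective : ∀ {n} {i j : E n} → W i ≡ W j → i ≡ j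
W-injective refl = refl

allCoords : ∀ n → List (Coord n)
allCoords n = map Z (allFin (ℕ.suc n)) ++ map W (allFin (ℕ.suc n))

∈-allCoords : ∀ {n} (t : Coord n) → t ∈ allCoords n
∈-allCoords     (Z i) = ∈-++⁺ˡ (∈-map⁺ Z (∈-allFin i))
∈-allCoords {n} (W i) = ∈-++⁺ʳ (map Z (allFin (ℕ.suc n))) (∈-map⁺ W (∈-allFin i))

module ProperCoords {n : ℕ} (k : E n) where

  Proper : Coord n → Set
  Proper t = index t ≢ k

  properCoord′ : Fin n ⊎ Fin n → Coord n
  properCoord′ = [ Z ∘ punchIn k , W ∘ punchIn k ]′

  properCoord : Fin (n ℕ.+ n) → Coord n
  properCoord j = properCoord′ (splitAt n j)

  properCoord-proper : ∀ j → Proper (properCoord j)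
  properCoord-proper j with splitAt n j
  ... | inj₁ i = Finₚ.punchInᵢ≢i k i
  ... | inj₂ i = Finₚ.punchInᵢ≢i k i

  properCoord′-injective : ∀ a b → properCoord′ a ≡ properCoord′ b → a ≡ b
  properCoord′-injective (inj₁ i) (inj₁ j) eq = cong inj₁ (Finₚ.punchIn-injective k i j (Z-injective eq))
  properCoord′-injective (inj₂ i) (inj₂ j) eq = cong inj₂ (Finₚ.punchIn-injective k i j (W-injective eq))
  properCoord′-injective (inj₁ i) (inj₂ j) ()
  properCoord′-injective (inj₂ i) (inj₁ j) ()

  properCoord-injective : ∀ {i j} → properCoord i ≡ properCoord j → i ≡ j
  properCoord-injective {i} {j} eq = begin
    i                       ≡⟨ Finₚ.join-splitAt n n i ⟨
    join n n (splitAt n i)  ≡⟨ cong (join n n) (properCoord′-injective (splitAt n i) (splitAt n j) eq) ⟩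
    join n n (splitAt n j)  ≡⟨ Finₚ.join-splitAt n n j ⟩
    j                       ∎
    where open ≡-Reasoning

  properCoord-surjective : ∀ {t} → Proper t → Σ (Fin (n ℕ.+ n)) λ j → properCoord j ≡ t
  properCoord-surjective {Z i} i≢k = punchOut (i≢k ∘ sym) ↑ˡ n , (begin
    properCoord′ (splitAt n (punchOut (i≢k ∘ sym) ↑ˡ n))  ≡⟨ cong properCoord′ (Finₚ.splitAt-↑ˡ n _ n) ⟩
    Z (punchIn k (punchOut (i≢k ∘ sym)))                  ≡⟨ cong Z (Finₚ.punchIn-punchOut _) ⟩
    Z i                                                   ∎)
    where open ≡-Reasoning
  properCoord-surjective {W i} i≢k = n ↑ʳ punchOut (i≢k ∘ sym) , (begin
    properCoord′ (splitAt n (n ↑ʳ punchOut (i≢k ∘ sym)))  ≡⟨ cong properCoord′ (Finₚ.splitAt-↑ʳ n n _) ⟩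
    W (punchIn k (punchOut (i≢k ∘ sym)))                  ≡⟨ cong W (Finₚ.punchIn-punchOut _) ⟩
    W i                                                   ∎)
    where open ≡-Reasoning

data Side : Set where
  up down : Side

_≟ˢ_ : (σ τ : Side) → Dec (σ ≡ τ)
up   ≟ˢ up   = yes refl
up   ≟ˢ down = no λ ()
down ≟ˢ up   = no λ ()
down ≟ˢ down = yes refl

module Points {c ℓ} (R : CommutativeRing c ℓ) {n : ℕ} (k : E n) where

  open CommutativeRing R hiding (zero) renaming (refl to ≈-refl; sym to ≈-sym; trans to ≈-trans)
  open import Algebra.Properties.Ring ring
    using (-0#≈0#; -‿involutive; -‿+-comm; //-rightDividesˡ; x[y-z]≈xy-xz)
  open import Algebra.Properties.CommutativeSemigroup +-commutativeSemigroup using (interchange)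
  open import Algebra.Properties.CommutativeSemigroup *-commutativeSemigroup using (x∙yz≈y∙xz)
  open import Algebra.Properties.Semiring.Sum semiring using (sum) public
  open import Relation.Binary.Reasoning.Setoid setoid

  Pt : Set c
  Pt = (E n → Carrier) × (E n → Carrier)

  _≈ᴾ_ : Pt → Pt → Set ℓ
  (z , w) ≈ᴾ (z′ , w′) = (∀ i j → z i - z′ i ≈ z j - z′ j) × (∀ i j → w i - w′ i ≈ w j - w′ j)

  0ᴾ : Pt
  0ᴾ = (λ _ → 0#) , (λ _ → 0#)

  _+ᴾ_ : Pt → Pt → Pt
  (z , w) +ᴾ (z′ , w′) = (λ i → z i + z′ i) , (λ i → w i + w′ i)

  _•ᴾ_ : Carrier → Pt → Pt
  a •ᴾ (z , w) = (λ i → a * z i) , (λ i → a * w i)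

  ∑ᴾ : ∀ {m} → (Fin m → Pt) → Pt
  ∑ᴾ {ℕ.zero}  f = 0ᴾ
  ∑ᴾ {ℕ.suc m} f = f zero +ᴾ ∑ᴾ (f ∘ suc)

  coord : Pt → Coord n → Carrier
  coord (z , w) (Z i) = z i - z k
  coord (z , w) (W i) = w k - w i

  x-y+y-z≈x-z : ∀ x y z → (x - y) + (y - z) ≈ x - z
  x-y+y-z≈x-z x y z = begin
    (x - y) + (y - z)  ≈⟨ +-assoc (x - y) y (- z) ⟨
    (x - y) + y - z    ≈⟨ +-congʳ (//-rightDividesˡ y x) ⟩
    x - z              ∎

  x-y≈u-v⇒x-u≈y-v : ∀ {x y u v} → x - y ≈ u - v → x - u ≈ y - v
  x-y≈u-v⇒x-u≈y-v {x} {y} {u} {v} eq = begin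
    x - u              ≈⟨ x-y+y-z≈x-z x y u ⟨
    (x - y) + (y - u)  ≈⟨ +-congʳ eq ⟩
    (u - v) + (y - u)  ≈⟨ +-comm (u - v) (y - u) ⟩
    (y - u) + (u - v)  ≈⟨ x-y+y-z≈x-z y u v ⟩
    y - v              ∎

  [x+y]-[u+v]≈[x-u]+[y-v] : ∀ x y u v → (x + y) - (u + v) ≈ (x - u) + (y - v)
  [x+y]-[u+v]≈[x-u]+[y-v] x y u v = begin
    (x + y) - (u + v)      ≈⟨ +-congˡ (-‿+-comm u v) ⟨
    (x + y) + (- u + - v)  ≈⟨ interchange x y (- u) (- v) ⟩
    (x - u) + (y - v)      ∎

  ≈ᴾ⇒coord≈ : ∀ {p q} → p ≈ᴾ q → ∀ t → coord p t ≈ coord q t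
  ≈ᴾ⇒coord≈ (z≈ , w≈) (Z i) = x-y≈u-v⇒x-u≈y-v (z≈ i k)
  ≈ᴾ⇒coord≈ (z≈ , w≈) (W i) = x-y≈u-v⇒x-u≈y-v (w≈ k i)

  coord≈⇒≈ᴾ : ∀ {p q} → (∀ t → coord p t ≈ coord q t) → p ≈ᴾ q
  coord≈⇒≈ᴾ eq =
    (λ i j → ≈-trans (x-y≈u-v⇒x-u≈y-v (eq (Z i))) (≈-sym (x-y≈u-v⇒x-u≈y-v (eq (Z j))))) ,
    (λ i j → ≈-trans (≈-sym (x-y≈u-v⇒x-u≈y-v (eq (W i)))) (x-y≈u-v⇒x-u≈y-v (eq (W j))))

  coord-base : ∀ p {t} → index t ≡ k → coord p t ≈ 0#
  coord-base (z , w) {Z _} refl = -‿inverseʳ (z k)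
  coord-base (z , w) {W _} refl = -‿inverseʳ (w k)

  record Linear (φ : Pt → Carrier) : Set (c ⊔ ℓ) where
    field
      homo-+ : ∀ p q → φ (p +ᴾ q) ≈ φ p + φ q
      homo-• : ∀ a p → φ (a •ᴾ p) ≈ a * φ p
      homo-0 : φ 0ᴾ ≈ 0#

  linear-∑ : ∀ {φ} → Linear φ → ∀ {m} (a : Fin m → Carrier) (q : Fin m → Pt) →
             φ (∑ᴾ (λ j → a j •ᴾ q j)) ≈ sum (λ j → a j * φ (q j))
  linear-∑ φ-lin {ℕ.zero}  a q = Linear.homo-0 φ-lin
  linear-∑ φ-lin {ℕ.suc m} a q =
    ≈-trans (homo-+ _ _) (+-cong (homo-• (a zero) (q zero)) (linear-∑ φ-lin (a ∘ suc) (q ∘ suc)))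
    where open Linear φ-lin

  coord-linear : ∀ t → Linear (λ p → coord p t)
  coord-linear (Z i) = record
    { homo-+ = λ p q → [x+y]-[u+v]≈[x-u]+[y-v] _ _ _ _
    ; homo-• = λ a p → ≈-sym (x[y-z]≈xy-xz a _ _)
    ; homo-0 = -‿inverseʳ 0#
    }
  coord-linear (W i) = record
    { homo-+ = λ p q → [x+y]-[u+v]≈[x-u]+[y-v] _ _ _ _
    ; homo-• = λ a p → ≈-sym (x[y-z]≈xy-xz a _ _)
    ; homo-0 = -‿inverseʳ 0#
    }

  scaled-difference-linear : ∀ {φ ψ} → Linear φ → Linear ψ → ∀ a → Linear (λ p → a * (φ p - ψ p))
  scaled-difference-linear {φ} {ψ} φ-lin ψ-lin a = record
    { homo-+ = λ p q → begin
        a * (φ (p +ᴾ q) - ψ (p +ᴾ q))      ≈⟨ *-congˡ (+-cong (φ.homo-+ p q) (-‿cong (ψ.homo-+ p q))) ⟩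
        a * ((φ p + φ q) - (ψ p + ψ q))    ≈⟨ *-congˡ ([x+y]-[u+v]≈[x-u]+[y-v] _ _ _ _) ⟩
        a * ((φ p - ψ p) + (φ q - ψ q))    ≈⟨ distribˡ a _ _ ⟩
        a * (φ p - ψ p) + a * (φ q - ψ q)  ∎
    ; homo-• = λ b p → begin
        a * (φ (b •ᴾ p) - ψ (b •ᴾ p))      ≈⟨ *-congˡ (+-cong (φ.homo-• b p) (-‿cong (ψ.homo-• b p))) ⟩
        a * (b * φ p - b * ψ p)            ≈⟨ *-congˡ (x[y-z]≈xy-xz b _ _) ⟨
        a * (b * (φ p - ψ p))              ≈⟨ x∙yz≈y∙xz a b _ ⟩
        b * (a * (φ p - ψ p))              ∎
    ; homo-0 = begin
        a * (φ 0ᴾ - ψ 0ᴾ)                  ≈⟨ *-congˡ (+-cong φ.homo-0 (-‿cong ψ.homo-0)) ⟩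
        a * (0# - 0#)                      ≈⟨ *-congˡ (-‿inverseʳ 0#) ⟩
        a * 0#                             ≈⟨ zeroʳ a ⟩
        0#                                 ∎
    }
    where
    module φ = Linear φ-lin
    module ψ = Linear ψ-lin

  fromCoords : (Coord n → Carrier) → Pt
  fromCoords f = (λ i → f (Z i)) , (λ i → - f (W i))

  coord-fromCoords : ∀ f → f (Z k) ≈ 0# → f (W k) ≈ 0# → ∀ t → coord (fromCoords f) t ≈ f t
  coord-fromCoords f fZk≈0 fWk≈0 (Z i) = begin
    f (Z i) - f (Z k)      ≈⟨ +-congˡ (-‿cong fZk≈0) ⟩
    f (Z i) - 0#           ≈⟨ +-congˡ -0#≈0# ⟩
    f (Z i) + 0#           ≈⟨ +-identityʳ (f (Z i)) ⟩
    f (Z i)                ∎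
  coord-fromCoords f fZk≈0 fWk≈0 (W i) = begin
    - f (W k) - - f (W i)  ≈⟨ +-cong (-‿cong fWk≈0) (-‿involutive (f (W i))) ⟩
    - 0# + f (W i)         ≈⟨ +-congʳ -0#≈0# ⟩
    0# + f (W i)           ≈⟨ +-identityˡ (f (W i)) ⟩
    f (W i)                ∎

-- The order of the coordinates at a generic point

module ChamberOrder {n : ℕ} (k : E n) (x₀ : QPt n) (x₀-generic : Generic k x₀) where

  open ProperCoords k public
  open import Data.List.Extrema (DecTotalOrder.totalOrder ℚₚ.≤-decTotalOrder)
    using (argmax; argmax-all; f[⊥]≤f[argmax]; f[xs]≤f[argmax])

  height : Coord n → ℚ
  height = Points.coord ℚₚ.+-*-commutativeRing k x₀

  height-base : ∀ {t} → index t ≡ k → height t ≡ 0ℚ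
  height-base {Z _} refl = ℚₚ.+-inverseʳ (proj₁ x₀ k)
  height-base {W _} refl = ℚₚ.+-inverseʳ (proj₂ x₀ k)

  private
    off-hyperplanes : ∀ L → Nontrivial k L → evalF k L x₀ ≢ 0ℚ
    off-hyperplanes = proj₂ x₀-generic

  height-injective : ∀ {s t} → Proper s → Proper t → height s ≡ height t → s ≡ t
  height-injective {Z i} {Z j} _ _ eq with i Finₚ.≟ j
  ... | yes i≡j = cong Z i≡j
  ... | no i≢j  = contradiction (p≡q⇒p-q≡0 eq) (off-hyperplanes (zz i j) i≢j)
  height-injective {W i} {W j} _ _ eq with i Finₚ.≟ j
  ... | yes i≡j = cong W i≡j
  ... | no i≢j  = contradiction (p≡q⇒p-q≡0 eq) (off-hyperplanes (ww i j) i≢j)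
  height-injective {Z i} {W j} i≢k _ eq =
    contradiction (p≡q⇒p-q≡0 eq) (off-hyperplanes (zw i j) (i≢k ∘ proj₁))
  height-injective {W i} {Z j} _ j≢k eq =
    contradiction (p≡q⇒p-q≡0 (sym eq)) (off-hyperplanes (zw j i) (j≢k ∘ proj₁))

  height-nonzero : ∀ {t} → Proper t → height t ≢ 0ℚ
  height-nonzero {Z i} i≢k eq =
    off-hyperplanes (zz i k) i≢k (p≡q⇒p-q≡0 (trans eq (sym (height-base {Z k} refl))))
  height-nonzero {W i} i≢k eq =
    off-hyperplanes (ww i k) i≢k (p≡q⇒p-q≡0 (trans eq (sym (height-base {W k} refl))))

  height-W<Z : ∀ {i} → i ≢ k → height (W i) ℚ.< height (Z i)
  height-W<Z {i} i≢k = ≤∧≢⇒< (proj₁ x₀-generic i) (λ eq → W≢Z (height-injective i≢k i≢k eq))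
    where
    W≢Z : W i ≢ Z i
    W≢Z ()

  level : Side → Coord n → ℚ
  level up   t = height t
  level down t = ℚ.- height t

  -- side, pred and above are opaque: once unfolded inside a goal, Agda starts normalising rational
  -- arithmetic on the symbolic entries of x₀, and type checking runs out of memory.
  opaque
    side : Coord n → Side
    side t = if does (0ℚ ℚ.<? height t) then up else down

    side-up : ∀ {t} → 0ℚ ℚ.< height t → side t ≡ up
    side-up {t} 0<h = cong (λ b → if b then up else down) (dec-true (0ℚ ℚ.<? height t) 0<h)

    side-down : ∀ {t} → ¬ 0ℚ ℚ.< height t → side t ≡ down
    side-down {t} 0≮h = cong (λ b → if b then up else down) (dec-false (0ℚ ℚ.<? height t) 0≮h)

  level-base : ∀ σ {t} → index t ≡ k → level σ t ≡ 0ℚ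
  level-base up   {t} t≡k = height-base {t} t≡k
  level-base down {t} t≡k = cong ℚ.-_ (height-base {t} t≡k)

  level-nonzero : ∀ σ {t} → Proper t → level σ t ≢ 0ℚ
  level-nonzero up   {t} pt = height-nonzero {t} pt
  level-nonzero down {t} pt = height-nonzero {t} pt ∘ ℚₚ.neg-injective

  level-injective : ∀ σ {s t} → Proper s → Proper t → level σ s ≡ level σ t → s ≡ t
  level-injective up   {s} {t} ps pt = height-injective {s} {t} ps pt
  level-injective down {s} {t} ps pt = height-injective {s} {t} ps pt ∘ ℚₚ.neg-injective

  level-opposite : ∀ {σ τ} → σ ≢ τ → ∀ t → level σ t ≡ ℚ.- level τ t
  level-opposite {up}   {up}   σ≢τ t = contradiction refl σ≢τ
  level-opposite {up}   {down} σ≢τ t = sym (neg-involutive (height t))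
  level-opposite {down} {up}   σ≢τ t = refl
  level-opposite {down} {down} σ≢τ t = contradiction refl σ≢τ

  level-side-pos : ∀ {t} → Proper t → 0ℚ ℚ.< level (side t) t
  level-side-pos {t} pt with ℚₚ.<-cmp 0ℚ (height t)
  ... | tri< 0<h _ _ = subst (λ σ → 0ℚ ℚ.< level σ t) (sym (side-up 0<h)) 0<h
  ... | tri≈ _ 0≡h _ = contradiction (sym 0≡h) (height-nonzero {t} pt)
  ... | tri> _ _ h<0 = subst (λ σ → 0ℚ ℚ.< level σ t) (sym (side-down (ℚₚ.<-asym h<0)))
                             (ℚₚ.neg-antimono-< h<0)

  side-unique : ∀ σ {t} → 0ℚ ℚ.< level σ t → side t ≡ σ
  side-unique up   0<h  = side-up 0<h
  side-unique down 0<-h = side-down λ 0<h → ℚₚ.<-asym 0<-h (ℚₚ.neg-antimono-< 0<h)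

  opaque
    -- The coordinate next to s on the way to 0 along the side of s; Z k stands for 0 itself.
    pred : Coord n → Coord n
    pred s = argmax (level (side s)) (Z k)
                    (filter (λ t → level (side s) t ℚ.<? level (side s) s) (allCoords n))

    pred-below : ∀ {s} → Proper s → level (side s) (pred s) ℚ.< level (side s) s
    pred-below {s} ps = argmax-all (level (side s)) {P = λ t → level (side s) t ℚ.< level (side s) s}
      (subst (ℚ._< level (side s) s) (sym (level-base (side s) {Z k} refl)) (level-side-pos ps))
      (all-filter (λ t → level (side s) t ℚ.<? level (side s) s) (allCoords n))

    pred-nonneg : ∀ s → 0ℚ ℚ.≤ level (side s) (pred s)
    pred-nonneg s = subst (ℚ._≤ level (side s) (pred s)) (level-base (side s) {Z k} refl)
      (f[⊥]≤f[argmax] {f = level (side s)} (Z k)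
        (filter (λ t → level (side s) t ℚ.<? level (side s) s) (allCoords n)))

    pred-max : ∀ {s t} → level (side s) t ℚ.< level (side s) s →
               level (side s) t ℚ.≤ level (side s) (pred s)
    pred-max {s} {t} t<s =
      All.lookup (f[xs]≤f[argmax] {f = level (side s)} (Z k)
                   (filter (λ t → level (side s) t ℚ.<? level (side s) s) (allCoords n)))
                 (∈-filter⁺ (λ t → level (side s) t ℚ.<? level (side s) s) (∈-allCoords t) t<s)

  pred-side : ∀ {s} → Proper (pred s) → side (pred s) ≡ side s
  pred-side {s} pps = side-unique (side s) (≤∧≢⇒< (pred-nonneg s) (level-nonzero (side s) pps ∘ sym))

  opaque
    above : Coord n → Coord n → Bool
    above u t = does (level (side u) u ℚ.≤? level (side u) t)

    above-self : ∀ u → above u u ≡ true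
    above-self u = dec-true (level (side u) u ℚ.≤? level (side u) u) ℚₚ.≤-refl

    above-pred : ∀ {s} → Proper s → above s (pred s) ≡ false
    above-pred {s} ps =
      dec-false (level (side s) s ℚ.≤? level (side s) (pred s)) (<⇒≱ (pred-below ps))

    above-base : ∀ {u t} → Proper u → index t ≡ k → above u t ≡ false
    above-base {u} {t} pu t≡k = dec-false (level (side u) u ℚ.≤? level (side u) t)
      (<⇒≱ (subst (ℚ._< level (side u) u) (sym (level-base (side u) t≡k)) (level-side-pos pu)))

    above-trans : ∀ {u s t} → above u s ≡ true → level (side u) s ℚ.≤ level (side u) t →
                  above u t ≡ true
    above-trans {u} {s} {t} s-above s≤t = dec-true (level (side u) u ℚ.≤? level (side u) t)
      (ℚₚ.≤-trans (does-true⇒ (level (side u) u ℚ.≤? level (side u) s) s-above) s≤t)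

    above-pred-stable : ∀ {s u} → Proper s → Proper u → s ≢ u → above u s ≡ above u (pred s)
    above-pred-stable {s} {u} ps pu s≢u with side s ≟ˢ side u
    ... | yes same = does-⇔ (mk⇔ pass-pred back) (level (side u) u ℚ.≤? level (side u) s)
                                               (level (side u) u ℚ.≤? level (side u) (pred s))
      where
      pass-pred : level (side u) u ℚ.≤ level (side u) s → level (side u) u ℚ.≤ level (side u) (pred s)
      pass-pred u≤s = subst (λ σ → level σ u ℚ.≤ level σ (pred s)) same
        (pred-max (subst (λ σ → level σ u ℚ.< level σ s) (sym same)
          (≤∧≢⇒< u≤s (s≢u ∘ sym ∘ level-injective (side u) pu ps))))
      back : level (side u) u ℚ.≤ level (side u) (pred s) → level (side u) u ℚ.≤ level (side u) s
      back u≤pred = ℚₚ.<⇒≤ (ℚₚ.≤-<-trans u≤pred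
        (subst (λ σ → level σ (pred s) ℚ.< level σ s) same (pred-below ps)))
    ... | no opposite =
      trans (dec-false (level (side u) u ℚ.≤? level (side u) s) (<⇒≱ s<u))
            (sym (dec-false (level (side u) u ℚ.≤? level (side u) (pred s)) (<⇒≱ pred<u)))
      where
      flip : ∀ t → level (side u) t ≡ ℚ.- level (side s) t
      flip = level-opposite (opposite ∘ sym)
      s<u : level (side u) s ℚ.< level (side u) u
      s<u = ℚₚ.<-trans (subst (ℚ._< 0ℚ) (sym (flip s)) (ℚₚ.neg-antimono-< (level-side-pos ps)))
                       (level-side-pos pu)
      pred<u : level (side u) (pred s) ℚ.< level (side u) u
      pred<u = ℚₚ.≤-<-trans
        (subst (ℚ._≤ 0ℚ) (sym (flip (pred s))) (ℚₚ.neg-antimono-≤ (pred-nonneg s)))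
        (level-side-pos pu)

  depth : Coord n → ℚ
  depth t = level (side t) t

  rank : Coord n → ℕ
  rank s = length (filter (λ t → depth t ℚ.<? depth s) (allCoords n))

  rank-pred : ∀ {s} → Proper s → Proper (pred s) → rank (pred s) ℕ.< rank s
  rank-pred {s} ps pps =
    length-filter-< (λ t → depth t ℚ.<? depth (pred s)) (λ t → depth t ℚ.<? depth s)
      (λ t<pred → ℚₚ.<-trans t<pred shallower) (∈-allCoords (pred s)) (ℚₚ.<-irrefl refl) shallower
    where
    shallower : depth (pred s) ℚ.< depth s
    shallower = subst (λ σ → level σ (pred s) ℚ.< depth s) (sym (pred-side pps)) (pred-below ps)

  descent : ∀ {r} (P : Coord n → Set r) → (∀ {t} → index t ≡ k → P t) →
            (∀ {s} → Proper s → P (pred s) → P s) → ∀ t → P t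
  descent P base step t = go t (ℕᵢ.<-wellFounded (rank t))
    where
    go : ∀ t → Acc ℕ._<_ (rank t) → P t
    go t (acc smaller) with index t Finₚ.≟ k
    ... | yes t≡k = base t≡k
    ... | no t≢k with index (pred t) Finₚ.≟ k
    ...   | yes pred≡k = step t≢k (base pred≡k)
    ...   | no pred≢k  = step t≢k (go (pred t) (smaller (rank-pred t≢k pred≢k)))

  -- Rays and jump coefficients

  module Coefficients {c ℓ} (R : CommutativeRing c ℓ) where

    open Points R k public
    open CommutativeRing R hiding (zero)
      renaming (refl to ≈-refl; sym to ≈-sym; trans to ≈-trans; reflexive to ≈-reflexive)
    open import Algebra.Properties.Ring ring using (-1*x≈-x; -‿involutive; -0#≈0#; //-rightDividesˡ)
    open import Relation.Binary.Reasoning.Setoid setoid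

    sgn : Side → Carrier
    sgn up   = 1#
    sgn down = - 1#

    sgn*sgn≈1 : ∀ σ → sgn σ * sgn σ ≈ 1#
    sgn*sgn≈1 up   = *-identityˡ 1#
    sgn*sgn≈1 down = ≈-trans (-1*x≈-x (- 1#)) (-‿involutive 1#)

    sgn-cancel : ∀ σ {x y} → sgn σ * x ≈ sgn σ * y → x ≈ y
    sgn-cancel σ {x} {y} eq = begin
      x                    ≈⟨ *-identityˡ x ⟨
      1# * x               ≈⟨ *-congʳ (sgn*sgn≈1 σ) ⟨
      sgn σ * sgn σ * x    ≈⟨ *-assoc (sgn σ) (sgn σ) x ⟩
      sgn σ * (sgn σ * x)  ≈⟨ *-congˡ eq ⟩
      sgn σ * (sgn σ * y)  ≈⟨ *-assoc (sgn σ) (sgn σ) y ⟨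
      sgn σ * sgn σ * y    ≈⟨ *-congʳ (sgn*sgn≈1 σ) ⟩
      1# * y               ≈⟨ *-identityˡ y ⟩
      y                    ∎

    ray : Coord n → Coord n → Carrier
    ray u t = if above u t then sgn (side u) else 0#

    ray-≡ : ∀ {u t b} → above u t ≡ b → ray u t ≈ (if b then sgn (side u) else 0#)
    ray-≡ {u} eq = ≈-reflexive (cong (λ b → if b then sgn (side u) else 0#) eq)

    generator : Coord n → Pt
    generator u = fromCoords (ray u)

    coord-generator : ∀ {u} → Proper u → ∀ t → coord (generator u) t ≈ ray u t
    coord-generator pu = coord-fromCoords _ (ray-≡ (above-base pu refl)) (ray-≡ (above-base pu refl))

    coefficient : Coord n → Pt → Carrier
    coefficient s p = sgn (side s) * (coord p s - coord p (pred s))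

    coefficient-linear : ∀ s → Linear (coefficient s)
    coefficient-linear s = scaled-difference-linear (coord-linear s) (coord-linear (pred s)) (sgn (side s))

    coefficient-cong : ∀ s {p q} → p ≈ᴾ q → coefficient s p ≈ coefficient s q
    coefficient-cong s p≈q = *-congˡ (+-cong (≈ᴾ⇒coord≈ p≈q s) (-‿cong (≈ᴾ⇒coord≈ p≈q (pred s))))

    jump : Coord n → Coord n → Carrier
    jump s u = sgn (side s) * (ray u s - ray u (pred s))

    jump-self : ∀ {s} → Proper s → jump s s ≈ 1#
    jump-self {s} ps = begin
      sgn (side s) * (ray s s - ray s (pred s))  ≈⟨ *-congˡ (+-cong (ray-≡ (above-self s))
                                                                     (-‿cong (ray-≡ (above-pred ps)))) ⟩
      sgn (side s) * (sgn (side s) - 0#)         ≈⟨ *-congˡ (≈-trans (+-congˡ -0#≈0#) (+-identityʳ _)) ⟩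
      sgn (side s) * sgn (side s)                ≈⟨ sgn*sgn≈1 (side s) ⟩
      1#                                         ∎

    jump-other : ∀ {s u} → Proper s → Proper u → s ≢ u → jump s u ≈ 0#
    jump-other {s} {u} ps pu s≢u = begin
      sgn (side s) * (ray u s - ray u (pred s))         ≈⟨ *-congˡ (+-congʳ (ray-≡ (above-pred-stable ps pu s≢u))) ⟩
      sgn (side s) * (ray u (pred s) - ray u (pred s))  ≈⟨ *-congˡ (-‿inverseʳ _) ⟩
      sgn (side s) * 0#                                 ≈⟨ zeroʳ _ ⟩
      0#                                                ∎

    coefficients-determine : ∀ {p q} → (∀ {s} → Proper s → coefficient s p ≈ coefficient s q) → p ≈ᴾ q
    coefficients-determine {p} {q} same = coord≈⇒≈ᴾ (descent (λ t → coord p t ≈ coord q t) (λ {t} → base {t}) step)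
      where
      base : ∀ {t} → index t ≡ k → coord p t ≈ coord q t
      base {t} t≡k = ≈-trans (coord-base p {t} t≡k) (≈-sym (coord-base q {t} t≡k))
      step : ∀ {s} → Proper s → coord p (pred s) ≈ coord q (pred s) → coord p s ≈ coord q s
      step {s} ps pred≈ = begin
        coord p s                                          ≈⟨ //-rightDividesˡ (coord p (pred s)) (coord p s) ⟨
        (coord p s - coord p (pred s)) + coord p (pred s)  ≈⟨ +-cong (sgn-cancel (side s) (same ps)) pred≈ ⟩
        (coord q s - coord q (pred s)) + coord q (pred s)  ≈⟨ //-rightDividesˡ (coord q (pred s)) (coord q s) ⟩
        coord q s                                          ∎

    module Basis (v : Fin (n ℕ.+ n) → Pt) (coord-v : ∀ j t → coord (v j) t ≈ ray (properCoord j) t) where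

      combination : (Fin (n ℕ.+ n) → Carrier) → Pt
      combination a = ∑ᴾ (λ j → a j •ᴾ v j)

      coefficients : Pt → Fin (n ℕ.+ n) → Carrier
      coefficients p i = coefficient (properCoord i) p

      coefficients-+ : ∀ p q i → coefficients (p +ᴾ q) i ≈ coefficients p i + coefficients q i
      coefficients-+ p q i = Linear.homo-+ (coefficient-linear (properCoord i)) p q

      coefficients-• : ∀ a p i → coefficients (a •ᴾ p) i ≈ a * coefficients p i
      coefficients-• a p i = Linear.homo-• (coefficient-linear (properCoord i)) a p

      coefficients-0 : ∀ i → coefficients 0ᴾ i ≈ 0#
      coefficients-0 i = Linear.homo-0 (coefficient-linear (properCoord i))

      coefficients-v : ∀ i j → coefficients (v j) i ≈ jump (properCoord i) (properCoord j)
      coefficients-v i j = *-congˡ (+-cong (coord-v j _) (-‿cong (coord-v j _)))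

      coefficients-v-self : ∀ i → coefficients (v i) i ≈ 1#
      coefficients-v-self i = ≈-trans (coefficients-v i i) (jump-self (properCoord-proper i))

      coefficients-v-other : ∀ {i j} → i ≢ j → coefficients (v i) j ≈ 0#
      coefficients-v-other {i} {j} i≢j = ≈-trans (coefficients-v j i)
        (jump-other (properCoord-proper j) (properCoord-proper i) (i≢j ∘ sym ∘ properCoord-injective))

      coefficients-combination : ∀ a i → coefficients (combination a) i ≈ a i
      coefficients-combination a i = begin
        coefficients (combination a) i          ≈⟨ linear-∑ (coefficient-linear (properCoord i)) a v ⟩
        sum (λ j → a j * coefficients (v j) i)  ≈⟨ sum-single +-commutativeMonoid _ i (λ j j≢i →
                                                     ≈-trans (*-congˡ (coefficients-v-other j≢i)) (zeroʳ (a j))) ⟩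
        a i * coefficients (v i) i              ≈⟨ *-congˡ (coefficients-v-self i) ⟩
        a i * 1#                                ≈⟨ *-identityʳ (a i) ⟩
        a i                                     ∎

      coefficients-injective : ∀ {p q} → (∀ i → coefficients p i ≈ coefficients q i) → p ≈ᴾ q
      coefficients-injective {p} {q} same = coefficients-determine λ ps →
        let (i , i↦s) = properCoord-surjective ps
        in subst (λ s → coefficient s p ≈ coefficient s q) i↦s (same i)

      expansion : ∀ p → p ≈ᴾ combination (coefficients p)
      expansion p = coefficients-injective λ i → ≈-sym (coefficients-combination (coefficients p) i)

      independence : ∀ a → combination a ≈ᴾ 0ᴾ → ∀ i → a i ≈ 0#
      independence a a≈0 i = begin
        a i                             ≈⟨ coefficients-combination a i ⟨
        coefficients (combination a) i  ≈⟨ coefficient-cong (properCoord i) a≈0 ⟩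
        coefficients 0ᴾ i               ≈⟨ coefficients-0 i ⟩
        0#                              ∎

      coefficientwise : ∀ {p q} i → coefficients p i ≈ coefficients q i →
                        (∀ j → j ≢ i → coefficients p j ≈ coefficients q j) → p ≈ᴾ q
      coefficientwise {p} {q} i at-i elsewhere = coefficients-injective agree
        where
        agree : ∀ j → coefficients p j ≈ coefficients q j
        agree j with j Finₚ.≟ i
        ... | yes refl = at-i
        ... | no j≢i   = elsewhere j j≢i

      supported⇒≈-multiple : ∀ {p} i → (∀ j → j ≢ i → coefficients p j ≈ 0#) →
                             p ≈ᴾ (coefficients p i •ᴾ v i)
      supported⇒≈-multiple {p} i vanish = coefficientwise i at-i elsewhere
        where
        a = coefficients p i
        at-i : a ≈ coefficients (a •ᴾ v i) i
        at-i = ≈-sym (≈-trans (coefficients-• a (v i) i)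
                              (≈-trans (*-congˡ (coefficients-v-self i)) (*-identityʳ a)))
        elsewhere : ∀ j → j ≢ i → coefficients p j ≈ coefficients (a •ᴾ v i) j
        elsewhere j j≢i = ≈-trans (vanish j j≢i) (≈-sym (≈-trans (coefficients-• a (v i) j)
                            (≈-trans (*-congˡ (coefficients-v-other (j≢i ∘ sym))) (zeroʳ a))))

      unit⇒≈v : ∀ {p} i → coefficients p i ≈ 1# → (∀ j → j ≢ i → coefficients p j ≈ 0#) → p ≈ᴾ v i
      unit⇒≈v i at-i vanish = coefficientwise i (≈-trans at-i (≈-sym (coefficients-v-self i)))
        (λ j j≢i → ≈-trans (vanish j j≢i) (≈-sym (coefficients-v-other (j≢i ∘ sym))))

  module ℤᶜ = Coefficients ℤₚ.+-*-commutativeRing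
  module ℚᶜ = Coefficients ℚₚ.+-*-commutativeRing

  generators : Fin (n ℕ.+ n) → ZPt n
  generators j = ℤᶜ.generator (properCoord j)

  module ℤᴮ = ℤᶜ.Basis generators (λ j → ℤᶜ.coord-generator (properCoord-proper j))

  coord-ι : ∀ u t → ℚᶜ.coord (ι u) t ≡ ℤᶜ.coord u t / 1
  coord-ι u (Z i) = sym (/1-homo-− (proj₁ u i) (proj₁ u k))
  coord-ι u (W i) = sym (/1-homo-− (proj₂ u k) (proj₂ u i))

  sgn-/1 : ∀ σ → ℤᶜ.sgn σ / 1 ≡ ℚᶜ.sgn σ
  sgn-/1 up   = refl
  sgn-/1 down = refl

  ray-/1 : ∀ u t → ℤᶜ.ray u t / 1 ≡ ℚᶜ.ray u t
  ray-/1 u t = trans (if-float (_/ 1) (above u t))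
                     (cong (λ a → if above u t then a else 0ℚ) (sgn-/1 (side u)))

  coord-ι-generators : ∀ j t → ℚᶜ.coord (ι (generators j)) t ≡ ℚᶜ.ray (properCoord j) t
  coord-ι-generators j t = begin
    ℚᶜ.coord (ι (generators j)) t     ≡⟨ coord-ι (generators j) t ⟩
    ℤᶜ.coord (generators j) t / 1     ≡⟨ cong (_/ 1) (ℤᶜ.coord-generator (properCoord-proper j) t) ⟩
    ℤᶜ.ray (properCoord j) t / 1      ≡⟨ ray-/1 (properCoord j) t ⟩
    ℚᶜ.ray (properCoord j) t          ∎
    where open ≡-Reasoning

  module ℚᴮ = ℚᶜ.Basis (ι ∘ generators) coord-ι-generators

  coefficient-ι : ∀ s u → ℚᶜ.coefficient s (ι u) ≡ ℤᶜ.coefficient s u / 1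
  coefficient-ι s u = begin
    ℚᶜ.sgn (side s) ℚ.* (ℚᶜ.coord (ι u) s ℚ.- ℚᶜ.coord (ι u) (pred s))
      ≡⟨ cong₂ (λ a b → ℚᶜ.sgn (side s) ℚ.* (a ℚ.- b)) (coord-ι u s) (coord-ι u (pred s)) ⟩
    ℚᶜ.sgn (side s) ℚ.* (zs / 1 ℚ.- zp / 1)
      ≡⟨ cong₂ ℚ._*_ (sym (sgn-/1 (side s))) (sym (/1-homo-− zs zp)) ⟩
    (ℤᶜ.sgn (side s) / 1) ℚ.* ((zs ℤ.- zp) / 1)
      ≡⟨ /1-homo-* (ℤᶜ.sgn (side s)) (zs ℤ.- zp) ⟨
    ℤᶜ.coefficient s u / 1
      ∎
    where
    open ≡-Reasoning
    zs = ℤᶜ.coord u s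
    zp = ℤᶜ.coord u (pred s)

  sumZ≡∑ᴾ : ∀ {m} (f : Fin m → ZPt n) → sumZ f ≡ ℤᶜ.∑ᴾ f
  sumZ≡∑ᴾ {ℕ.zero}  f = refl
  sumZ≡∑ᴾ {ℕ.suc m} f = cong (f zero +Z_) (sumZ≡∑ᴾ (f ∘ suc))

  sumQ≡∑ᴾ : ∀ {m} (f : Fin m → QPt n) → sumQ f ≡ ℚᶜ.∑ᴾ f
  sumQ≡∑ᴾ {ℕ.zero}  f = refl
  sumQ≡∑ᴾ {ℕ.suc m} f = cong (f zero +Q_) (sumQ≡∑ᴾ (f ∘ suc))

  generators-isZBasis : IsZBasis generators
  generators-isZBasis = spanning , independent
    where
    spanning : ∀ x → Σ (Fin (n ℕ.+ n) → ℤ.ℤ) λ a → x ≈Z sumZ (λ j → a j •Z generators j)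
    spanning x = ℤᴮ.coefficients x ,
      subst (x ≈Z_) (sym (sumZ≡∑ᴾ (λ j → ℤᴮ.coefficients x j •Z generators j))) (ℤᴮ.expansion x)
    independent : ∀ a → sumZ (λ j → a j •Z generators j) ≈Z 0Z → ∀ j → a j ≡ ℤ.+ 0
    independent a a≈0 = ℤᴮ.independence a (subst (_≈Z 0Z) (sumZ≡∑ᴾ (λ j → a j •Z generators j)) a≈0)

  -- The chamber as the cone over the generators

  Monotone : QPt n → Set
  Monotone x = ∀ α β → height β ℚ.< height α → ℚᶜ.coord x β ℚ.≤ ℚᶜ.coord x α

  chamber⇒monotone : ∀ {x} → Chamber k x₀ x → Monotone x
  chamber⇒monotone (_ , signs) (Z i) (Z j) β<α = 0≤q-p⇒p≤q (proj₁ (signs (zz i j)) (p<q⇒0<q-p β<α))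
  chamber⇒monotone (_ , signs) (W i) (W j) β<α = 0≤q-p⇒p≤q (proj₁ (signs (ww i j)) (p<q⇒0<q-p β<α))
  chamber⇒monotone (_ , signs) (Z i) (W j) β<α = 0≤q-p⇒p≤q (proj₁ (signs (zw i j)) (p<q⇒0<q-p β<α))
  chamber⇒monotone (_ , signs) (W i) (Z j) β<α = p-q≤0⇒p≤q (proj₂ (signs (zw j i)) (p<q⇒p-q<0 β<α))

  monotone⇒chamber : ∀ {x} → Monotone x → Chamber k x₀ x
  monotone⇒chamber {x} mono = in-cone , signs
    where
    in-cone : InC k x
    in-cone i with i Finₚ.≟ k
    ... | yes refl = ℚₚ.≤-reflexive (trans (ℚᶜ.coord-base x {W k} refl) (sym (ℚᶜ.coord-base x {Z k} refl)))
    ... | no i≢k   = mono (Z i) (W i) (height-W<Z i≢k)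
    compatible : ∀ α β →
      (0ℚ ℚ.< height α ℚ.- height β → 0ℚ ℚ.≤ ℚᶜ.coord x α ℚ.- ℚᶜ.coord x β) ×
      (height α ℚ.- height β ℚ.< 0ℚ → ℚᶜ.coord x α ℚ.- ℚᶜ.coord x β ℚ.≤ 0ℚ)
    compatible α β = (λ β<α → p≤q⇒0≤q-p (mono α β (0<q-p⇒p<q β<α))) ,
                     (λ α<β → p≤q⇒p-q≤0 (mono β α (p-q<0⇒p<q α<β)))
    signs : ∀ L → _
    signs (zz i j) = compatible (Z i) (Z j)
    signs (ww i j) = compatible (W i) (W j)
    signs (zw i j) = compatible (Z i) (W j)

  monotone-≈ : ∀ {x y} → x ≈Q y → Monotone y → Monotone x
  monotone-≈ x≈y mono α β β<α =
    subst₂ ℚ._≤_ (sym (ℚᶜ.≈ᴾ⇒coord≈ x≈y β)) (sym (ℚᶜ.≈ᴾ⇒coord≈ x≈y α)) (mono α β β<α)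

  sign-step-mono : ∀ σ {a b : Bool} → (σ ≡ up → b ≡ true → a ≡ true) → (σ ≡ down → a ≡ true → b ≡ true) →
                   (if b then ℚᶜ.sgn σ else 0ℚ) ℚ.≤ (if a then ℚᶜ.sgn σ else 0ℚ)
  sign-step-mono up   {true}  {true}  _   _   = ℚₚ.≤-refl
  sign-step-mono up   {true}  {false} _   _   = ℚ.*≤* (ℤ.+≤+ ℕ.z≤n)
  sign-step-mono up   {false} {true}  b⇒a _   with () ← b⇒a refl refl
  sign-step-mono up   {false} {false} _   _   = ℚₚ.≤-refl
  sign-step-mono down {true}  {true}  _   _   = ℚₚ.≤-refl
  sign-step-mono down {true}  {false} _   a⇒b with () ← a⇒b refl refl
  sign-step-mono down {false} {true}  _   _   = ℚ.*≤* ℤ.-≤+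
  sign-step-mono down {false} {false} _   _   = ℚₚ.≤-refl

  ray-monotone : ∀ u {α β} → height β ℚ.< height α → ℚᶜ.ray u β ℚ.≤ ℚᶜ.ray u α
  ray-monotone u {α} {β} β<α = sign-step-mono (side u) upward downward
    where
    upward : side u ≡ up → above u β ≡ true → above u α ≡ true
    upward eq β-above = above-trans β-above
      (subst (λ σ → level σ β ℚ.≤ level σ α) (sym eq) (ℚₚ.<⇒≤ β<α))
    downward : side u ≡ down → above u α ≡ true → above u β ≡ true
    downward eq α-above = above-trans α-above
      (subst (λ σ → level σ α ℚ.≤ level σ β) (sym eq) (ℚₚ.<⇒≤ (ℚₚ.neg-antimono-< β<α)))

  combination-monotone : ∀ a → (∀ j → 0ℚ ℚ.≤ a j) → Monotone (ℚᴮ.combination a)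
  combination-monotone a a≥0 α β β<α = begin
    ℚᶜ.coord (ℚᴮ.combination a) β                         ≡⟨ ℚᶜ.linear-∑ (ℚᶜ.coord-linear β) a (ι ∘ generators) ⟩
    ℚΣ.sum (λ j → a j ℚ.* ℚᶜ.coord (ι (generators j)) β)  ≤⟨ sum-mono-≤ termwise ⟩
    ℚΣ.sum (λ j → a j ℚ.* ℚᶜ.coord (ι (generators j)) α)  ≡⟨ ℚᶜ.linear-∑ (ℚᶜ.coord-linear α) a (ι ∘ generators) ⟨
    ℚᶜ.coord (ℚᴮ.combination a) α                         ∎
    where
    open ℚₚ.≤-Reasoning
    termwise : ∀ j → a j ℚ.* ℚᶜ.coord (ι (generators j)) β ℚ.≤ a j ℚ.* ℚᶜ.coord (ι (generators j)) α
    termwise j = ℚₚ.*-monoˡ-≤-nonNeg (a j) {{ℚ.nonNegative (a≥0 j)}}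
      (subst₂ ℚ._≤_ (sym (coord-ι-generators j β)) (sym (coord-ι-generators j α))
                    (ray-monotone (properCoord j) β<α))

  monotone⇒coefficient-nonneg : ∀ {x} → Monotone x → ∀ {s} → Proper s → 0ℚ ℚ.≤ ℚᶜ.coefficient s x
  monotone⇒coefficient-nonneg {x} mono {s} ps = oriented (side s) refl
    where
    open import Algebra.Properties.Ring ℚₚ.+-*-ring using (-1*x≈-x)
    gap : ℚ
    gap = ℚᶜ.coord x s ℚ.- ℚᶜ.coord x (pred s)
    pred<s : ∀ {σ} → side s ≡ σ → level σ (pred s) ℚ.< level σ s
    pred<s eq = subst (λ σ → level σ (pred s) ℚ.< level σ s) eq (pred-below ps)
    oriented : ∀ σ → side s ≡ σ → 0ℚ ℚ.≤ ℚᶜ.sgn σ ℚ.* gap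
    oriented up   eq = subst (0ℚ ℚ.≤_) (sym (ℚₚ.*-identityˡ gap))
      (p≤q⇒0≤q-p (mono s (pred s) (pred<s eq)))
    oriented down eq = subst (0ℚ ℚ.≤_) (sym (-1*x≈-x gap))
      (ℚₚ.neg-antimono-≤ (p≤q⇒p-q≤0 (mono (pred s) s (neg-cancel-< (pred<s eq)))))

  chamber⇒coefficients-nonneg : ∀ {x} → Chamber k x₀ x → ∀ j → 0ℚ ℚ.≤ ℚᴮ.coefficients x j
  chamber⇒coefficients-nonneg x∈C j =
    monotone⇒coefficient-nonneg (chamber⇒monotone x∈C) (properCoord-proper j)

  coefficients-nonneg⇒chamber : ∀ {x} → (∀ j → 0ℚ ℚ.≤ ℚᴮ.coefficients x j) → Chamber k x₀ x
  coefficients-nonneg⇒chamber {x} x≥0 =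
    monotone⇒chamber (monotone-≈ (ℚᴮ.expansion x) (combination-monotone _ x≥0))

  chamber⇒posHull : ∀ {x} → Chamber k x₀ x → PosHull generators x
  chamber⇒posHull {x} x∈C = ℚᴮ.coefficients x , chamber⇒coefficients-nonneg x∈C ,
    subst (x ≈Q_) (sym (sumQ≡∑ᴾ (λ j → ℚᴮ.coefficients x j •Q ι (generators j)))) (ℚᴮ.expansion x)

  posHull⇒chamber : ∀ {x} → PosHull generators x → Chamber k x₀ x
  posHull⇒chamber {x} (a , a≥0 , x≈) = monotone⇒chamber
    (monotone-≈ (subst (x ≈Q_) (sumQ≡∑ᴾ (λ j → a j •Q ι (generators j))) x≈) (combination-monotone a a≥0))

  -- Extreme rays and primitive generators

  coefficients-of-sum : ∀ {x y X τ} → (x +Q y) ≈Q (τ •Q X) →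
    ∀ j → ℚᴮ.coefficients x j ℚ.+ ℚᴮ.coefficients y j ≡ τ ℚ.* ℚᴮ.coefficients X j
  coefficients-of-sum {x} {y} {X} {τ} x+y≈τX j =
    trans (sym (ℚᴮ.coefficients-+ x y j))
          (trans (ℚᶜ.coefficient-cong (properCoord j) x+y≈τX) (ℚᴮ.coefficients-• τ X j))

  unit⇒extremeRay : ∀ {X} i → ℚᴮ.coefficients X i ≡ 1ℚ → (∀ j → j ≢ i → ℚᴮ.coefficients X j ≡ 0ℚ) →
                    ExtremeRay (Chamber k x₀) X
  unit⇒extremeRay {X} i Xᵢ≡1 Xⱼ≡0 = coefficients-nonneg⇒chamber X≥0 , X≉0 , extremal
    where
    X≥0 : ∀ j → 0ℚ ℚ.≤ ℚᴮ.coefficients X j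
    X≥0 j with j Finₚ.≟ i
    ... | yes refl = subst (0ℚ ℚ.≤_) (sym Xᵢ≡1) (ℚ.*≤* (ℤ.+≤+ ℕ.z≤n))
    ... | no j≢i   = ℚₚ.≤-reflexive (sym (Xⱼ≡0 j j≢i))

    X≉0 : ¬ X ≈Q 0Q
    X≉0 X≈0 = ℚₚ.1≢0 (trans (sym Xᵢ≡1)
                           (trans (ℚᶜ.coefficient-cong (properCoord i) X≈0) (ℚᴮ.coefficients-0 i)))

    summand-onRay : ∀ {x y τ} → Chamber k x₀ x → Chamber k x₀ y →
      (∀ j → ℚᴮ.coefficients x j ℚ.+ ℚᴮ.coefficients y j ≡ τ ℚ.* ℚᴮ.coefficients X j) → OnRay X x
    summand-onRay {x} {y} {τ} x∈C y∈C sum-eq = t , x≥0 i , ℚᴮ.coefficientwise i at-i elsewhere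
      where
      x≥0 = chamber⇒coefficients-nonneg x∈C
      t = ℚᴮ.coefficients x i
      at-i : t ≡ ℚᴮ.coefficients (t •Q X) i
      at-i = sym (trans (ℚᴮ.coefficients-• t X i) (trans (cong (t ℚ.*_) Xᵢ≡1) (ℚₚ.*-identityʳ t)))
      elsewhere : ∀ j → j ≢ i → ℚᴮ.coefficients x j ≡ ℚᴮ.coefficients (t •Q X) j
      elsewhere j j≢i = begin
        ℚᴮ.coefficients x j         ≡⟨ 0≤p∧0≤q∧p+q≡0⇒p≡0 (x≥0 j) (chamber⇒coefficients-nonneg y∈C j)
                                         (trans (sum-eq j) (trans (cong (τ ℚ.*_) (Xⱼ≡0 j j≢i)) (ℚₚ.*-zeroʳ τ))) ⟩
        0ℚ                          ≡⟨ ℚₚ.*-zeroʳ t ⟨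
        t ℚ.* 0ℚ                    ≡⟨ cong (t ℚ.*_) (Xⱼ≡0 j j≢i) ⟨
        t ℚ.* ℚᴮ.coefficients X j   ≡⟨ ℚᴮ.coefficients-• t X j ⟨
        ℚᴮ.coefficients (t •Q X) j  ∎
        where open ≡-Reasoning

    extremal : ∀ x y → Chamber k x₀ x → Chamber k x₀ y → OnRay X (x +Q y) → OnRay X x × OnRay X y
    extremal x y x∈C y∈C (τ , _ , x+y≈τX) =
      summand-onRay {x} {y} {τ} x∈C y∈C (coefficients-of-sum {x} {y} {X} {τ} x+y≈τX) ,
      summand-onRay {y} {x} {τ} y∈C x∈C λ j →
        trans (ℚₚ.+-comm (ℚᴮ.coefficients y j) (ℚᴮ.coefficients x j)) (coefficients-of-sum {x} {y} {X} {τ} x+y≈τX j)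

  extremeRay-nonzero-coefficient : ∀ {X} → ExtremeRay (Chamber k x₀) X →
                                   Σ (Fin (n ℕ.+ n)) λ i → ℚᴮ.coefficients X i ≢ 0ℚ
  extremeRay-nonzero-coefficient {X} (_ , X≉0 , _) =
    Finₚ.¬∀⟶∃¬ (n ℕ.+ n) (λ j → ℚᴮ.coefficients X j ≡ 0ℚ) (λ j → ℚᴮ.coefficients X j ℚ.≟ 0ℚ)
      (λ c≡0 → X≉0 (ℚᴮ.coefficients-injective (λ j → trans (c≡0 j) (sym (ℚᴮ.coefficients-0 j)))))

  -- X is the sum of y₁, the combination with the coefficients of X except the i-th one, and of the
  -- remainder y₂.  Both lie in the chamber, so y₁ lies on the ray of X; as its i-th coefficient is 0
  -- while that of X is not, y₁ ≈ 0, and the coefficients of X off i vanish.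
  extremeRay-supported : ∀ {X} → ExtremeRay (Chamber k x₀) X → ∀ i → ℚᴮ.coefficients X i ≢ 0ℚ →
                         ∀ j → j ≢ i → ℚᴮ.coefficients X j ≡ 0ℚ
  extremeRay-supported {X} (X∈C , _ , extremal) i cᵢ≢0 = others
    where
    c = ℚᴮ.coefficients X
    c≥0 = chamber⇒coefficients-nonneg X∈C

    erased : Fin (n ℕ.+ n) → ℚ
    erased = updateAt c i (λ _ → 0ℚ)
    erased-i : erased i ≡ 0ℚ
    erased-i = updateAt-updates i c
    erased-j : ∀ {j} → j ≢ i → erased j ≡ c j
    erased-j {j} j≢i = updateAt-minimal j i c j≢i

    remainder : Fin (n ℕ.+ n) → ℚ
    remainder j = c j ℚ.- erased j

    y₁ y₂ : QPt n
    y₁ = ℚᴮ.combination erased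
    y₂ = ℚᴮ.combination remainder

    y₁∈C : Chamber k x₀ y₁
    y₁∈C = coefficients-nonneg⇒chamber λ j →
      subst (0ℚ ℚ.≤_) (sym (ℚᴮ.coefficients-combination erased j)) (erased≥0 j)
      where
      erased≥0 : ∀ j → 0ℚ ℚ.≤ erased j
      erased≥0 j with j Finₚ.≟ i
      ... | yes refl = ℚₚ.≤-reflexive (sym erased-i)
      ... | no j≢i   = subst (0ℚ ℚ.≤_) (sym (erased-j j≢i)) (c≥0 j)

    y₂∈C : Chamber k x₀ y₂
    y₂∈C = coefficients-nonneg⇒chamber λ j →
      subst (0ℚ ℚ.≤_) (sym (ℚᴮ.coefficients-combination remainder j)) (remainder≥0 j)
      where
      remainder≥0 : ∀ j → 0ℚ ℚ.≤ remainder j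
      remainder≥0 j with j Finₚ.≟ i
      ... | yes refl = subst (λ r → 0ℚ ℚ.≤ c i ℚ.- r) (sym erased-i)
                             (subst (0ℚ ℚ.≤_) (sym (ℚₚ.+-identityʳ (c i))) (c≥0 i))
      ... | no j≢i   = ℚₚ.≤-reflexive (sym (trans (cong (λ r → c j ℚ.- r) (erased-j j≢i)) (ℚₚ.+-inverseʳ (c j))))

    y₁+y₂≈X : (y₁ +Q y₂) ≈Q (1ℚ •Q X)
    y₁+y₂≈X = ℚᴮ.coefficients-injective λ j → begin
      ℚᴮ.coefficients (y₁ +Q y₂) j                   ≡⟨ ℚᴮ.coefficients-+ y₁ y₂ j ⟩
      ℚᴮ.coefficients y₁ j ℚ.+ ℚᴮ.coefficients y₂ j  ≡⟨ cong₂ ℚ._+_ (ℚᴮ.coefficients-combination erased j)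
                                                                    (ℚᴮ.coefficients-combination remainder j) ⟩
      erased j ℚ.+ (c j ℚ.- erased j)                ≡⟨ ℚₚ.+-comm (erased j) _ ⟩
      c j ℚ.- erased j ℚ.+ erased j                  ≡⟨ p-q+q≡p (c j) (erased j) ⟩
      c j                                            ≡⟨ ℚₚ.*-identityˡ (c j) ⟨
      1ℚ ℚ.* c j                                     ≡⟨ ℚᴮ.coefficients-• 1ℚ X j ⟨
      ℚᴮ.coefficients (1ℚ •Q X) j                    ∎
      where open ≡-Reasoning

    y₁-onRay : OnRay X y₁
    y₁-onRay = proj₁ (extremal y₁ y₂ y₁∈C y₂∈C (1ℚ , ℚ.*≤* (ℤ.+≤+ ℕ.z≤n) , y₁+y₂≈X))
    τ = proj₁ y₁-onRay

    erased≡τc : ∀ j → erased j ≡ τ ℚ.* c j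
    erased≡τc j = trans (sym (ℚᴮ.coefficients-combination erased j))
      (trans (ℚᶜ.coefficient-cong (properCoord j) (proj₂ (proj₂ y₁-onRay))) (ℚᴮ.coefficients-• τ X j))

    τ≡0 : τ ≡ 0ℚ
    τ≡0 = p*q≡0∧q≢0⇒p≡0 (trans (sym (erased≡τc i)) erased-i) cᵢ≢0

    others : ∀ j → j ≢ i → c j ≡ 0ℚ
    others j j≢i = begin
      c j           ≡⟨ erased-j j≢i ⟨
      erased j      ≡⟨ erased≡τc j ⟩
      τ ℚ.* c j     ≡⟨ cong (ℚ._* c j) τ≡0 ⟩
      0ℚ ℚ.* c j    ≡⟨ ℚₚ.*-zeroˡ (c j) ⟩
      0ℚ            ∎
      where open ≡-Reasoning

  primitive⇒generator : ∀ {u} → PrimitiveRayGen (Chamber k x₀) u → ∃[ i ] (u ≈Z generators i)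
  primitive⇒generator {u} (ιu-extreme , primitivity) with extremeRay-nonzero-coefficient ιu-extreme
  ... | i , cᵢ≢0 = i , ℤᴮ.unit⇒≈v i dᵢ≡1 dⱼ≡0
    where
    d = ℤᴮ.coefficients u

    dⱼ≡0 : ∀ j → j ≢ i → d j ≡ ℤ.0ℤ
    dⱼ≡0 j j≢i = /1-injective
      (trans (sym (coefficient-ι (properCoord j) u)) (extremeRay-supported ιu-extreme i cᵢ≢0 j j≢i))

    N = ℤ.∣ d i ∣
    N≡dᵢ : ℤ.+ N ≡ d i
    N≡dᵢ = /1-nonneg (subst (0ℚ ℚ.≤_) (coefficient-ι (properCoord i) u)
                           (chamber⇒coefficients-nonneg (proj₁ ιu-extreme) i))

    u≈N•vᵢ : u ≈Z ((ℤ.+ N) •Z generators i)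
    u≈N•vᵢ = subst (λ a → u ≈Z (a •Z generators i)) (sym N≡dᵢ) (ℤᴮ.supported⇒≈-multiple i dⱼ≡0)

    dᵢ≡1 : d i ≡ ℤ.+ 1
    dᵢ≡1 = trans (sym N≡dᵢ) (cong ℤ.+_ (primitivity N (generators i) u≈N•vᵢ))

  generator⇒primitive : ∀ {u i} → u ≈Z generators i → PrimitiveRayGen (Chamber k x₀) u
  generator⇒primitive {u} {i} u≈vᵢ = unit⇒extremeRay i ιu-at-i ιu-elsewhere , primitivity
    where
    same : ∀ j → ℤᴮ.coefficients u j ≡ ℤᴮ.coefficients (generators i) j
    same j = ℤᶜ.coefficient-cong (properCoord j) {u} {generators i} u≈vᵢ

    ιu-at-i : ℚᴮ.coefficients (ι u) i ≡ 1ℚ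
    ιu-at-i = trans (coefficient-ι (properCoord i) u)
                    (cong (_/ 1) (trans (same i) (ℤᴮ.coefficients-v-self i)))

    ιu-elsewhere : ∀ j → j ≢ i → ℚᴮ.coefficients (ι u) j ≡ 0ℚ
    ιu-elsewhere j j≢i = trans (coefficient-ι (properCoord j) u)
                               (cong (_/ 1) (trans (same j) (ℤᴮ.coefficients-v-other (j≢i ∘ sym))))

    primitivity : ∀ (m : ℕ) u′ → u ≈Z ((ℤ.+ m) •Z u′) → m ≡ 1
    primitivity m u′ u≈m•u′ = ℕₚ.m*n≡1⇒m≡1 m ℤ.∣ dᵢ′ ∣
      (trans (sym (ℤₚ.abs-* (ℤ.+ m) dᵢ′)) (cong ℤ.∣_∣ (sym 1≡m*dᵢ′)))
      where
      dᵢ′ = ℤᴮ.coefficients u′ i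
      1≡m*dᵢ′ : ℤ.+ 1 ≡ ℤ.+ m ℤ.* dᵢ′
      1≡m*dᵢ′ = trans (sym (trans (same i) (ℤᴮ.coefficients-v-self i)))
        (trans (ℤᶜ.coefficient-cong (properCoord i) {u} {(ℤ.+ m) •Z u′} u≈m•u′)
               (ℤᴮ.coefficients-• (ℤ.+ m) u′ i))

proposition2p18 : (n : ℕ) → 1 ≤ n → (k : E n) → (x₀ : QPt n) → Generic k x₀ →
    ∃[ m ] Σ (Fin m → ZPt n) λ v →
      IsZBasis v ×
      (∀ (u : ZPt n) → (PrimitiveRayGen (Chamber k x₀) u → ∃[ i ] (u ≈Z v i)) ×
                       ((∃[ i ] (u ≈Z v i)) → PrimitiveRayGen (Chamber k x₀) u)) ×
      (∀ (x : QPt n) → (Chamber k x₀ x → PosHull v x) × (PosHull v x → Chamber k x₀ x))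
proposition2p18 n _ k x₀ x₀-generic =
  n ℕ.+ n , generators , generators-isZBasis ,
  (λ u → primitive⇒generator {u} , λ (_ , u≈vᵢ) → generator⇒primitive {u} u≈vᵢ) ,
  (λ x → chamber⇒posHull {x} , posHull⇒chamber {x})
  where open ChamberOrder k x₀ x₀-generic
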